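{- Let $\mathbb{F}$ be a field, let $n,s$ be positive integers, and let $T$ be a nonzero element of the antisymmetric subspace of $(\mathbb{F}^n)^{\otimes s}$. Then $\operatorname{Trank}(T)\ge s$.
   Context: The antisymmetric subspace of $(\mathbb{F}^n)^{\otimes s}$ is the span of all vectors $\sum_{\sigma\in S_s}\operatorname{sgn}(\sigma)\,\mathbf{e}_{i_{\sigma(1)}}\otimes\cdots\otimes\mathbf{e}_{i_{\sigma(s)}}$ for $1\le i_1<i_2<\cdots<i_s\le n$, where $\mathbf{e}_j$ is the standard basis of $\mathbb{F}^n$ (this definition is used in all characteristics, including $2$). $\operatorname{Trank}(T)$ is the least $r$ such that $T$ is a sum of $r$ elementary tensors $\mathbf{v_1}\otimes\cdots\otimes\mathbf{v_s}$ with $\mathbf{v_i}\in\mathbb{F}^n$. -}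

module Defs where

open import Level using (_⊔_; suc)
open import Algebra.Bundles using (CommutativeRing)
open import Data.Nat as ℕ using (ℕ; zero; suc)
open import Data.Fin as Fin using (Fin)
open import Data.Fin.Properties using (_≟_; _<?_)
import Data.Fin.Properties as FinP
open import Data.List as List using (List; []; _∷_; allFin; concatMap; map; filter; foldr)
open import Data.List.Relation.Unary.All using (All)
open import Data.Vec.Functional as VF using (Vector)
open import Data.Product using (∃; _×_; _,_; proj₁; proj₂)
open import Data.Bool using (true; false)
open import Relation.Nullary using (¬_; Dec; yes; no; does)
open import Relation.Nullary.Decidable using (_→-dec_; _×-dec_)
open import Relation.Binary.PropositionalEquality using (_≡_)

record Field (c ℓ : Level.Level) : Set (Level.suc (c ⊔ ℓ)) where
  field
    commutativeRing : CommutativeRing c ℓ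
  open CommutativeRing commutativeRing public
  field
    0≉1     : ¬ (0# ≈ 1#)
    inverse : ∀ x → ¬ (x ≈ 0#) → ∃ λ y → (x * y) ≈ 1#

allFuns : (s n : ℕ) → List (Fin s → Fin n)
allFuns zero    n = (λ ()) ∷ []
allFuns (suc s) n = concatMap (λ f → map (λ x → x VF.∷ f) (allFin n)) (allFuns s n)

Injective : ∀ {s n} → (Fin s → Fin n) → Set
Injective {s} σ = ∀ (a b : Fin s) → σ a ≡ σ b → a ≡ b

injective? : ∀ {s n} (σ : Fin s → Fin n) → Dec (Injective σ)
injective? σ = FinP.all? λ a → FinP.all? λ b → (σ a ≟ σ b) →-dec (a ≟ b)

StrictlyIncreasing : ∀ {s n} → (Fin s → Fin n) → Set
StrictlyIncreasing {s} i = ∀ (a b : Fin s) → a Fin.< b → i a Fin.< i b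

inversions : ∀ {s} → (Fin s → Fin s) → ℕ
inversions {s} σ =
  List.length (filter (λ p → (proj₁ p <? proj₂ p)
                              ×-dec (σ (proj₂ p) <? σ (proj₁ p)))
                      (List.cartesianProduct (allFin s) (allFin s)))

module FieldDefs {c ℓ : Level.Level} (F : Field c ℓ) where
  open Field F

  -- Elements of (F^n)^{⊗ s}: functions from multi-indices (Fin s → Fin n) to F.
  Tensor : ℕ → ℕ → Set c
  Tensor n s = (Fin s → Fin n) → Carrier

  _≈ᵀ_ : ∀ {n s} → Tensor n s → Tensor n s → Set ℓ
  T ≈ᵀ U = ∀ idx → T idx ≈ U idx

  zeroᵀ : ∀ {n s} → Tensor n s
  zeroᵀ _ = 0#

  _+ᵀ_ : ∀ {n s} → Tensor n s → Tensor n s → Tensor n s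
  (T +ᵀ U) idx = T idx + U idx

  _·ᵀ_ : ∀ {n s} → Carrier → Tensor n s → Tensor n s
  (a ·ᵀ T) idx = a * T idx

  sumᵀ : ∀ {n s} → List (Tensor n s) → Tensor n s
  sumᵀ = foldr _+ᵀ_ zeroᵀ

  Σ[<_] : (r : ℕ) → (Fin r → Carrier) → Carrier
  Σ[< zero  ] f = 0#
  Σ[< suc r ] f = f Fin.zero + Σ[< r ] (λ k → f (Fin.suc k))

  Π[<_] : (r : ℕ) → (Fin r → Carrier) → Carrier
  Π[< zero  ] f = 1#
  Π[< suc r ] f = f Fin.zero * Π[< r ] (λ k → f (Fin.suc k))

  signPow : ℕ → Carrier
  signPow zero    = 1#
  signPow (suc k) = - signPow k

  sgn : ∀ {s} → (Fin s → Fin s) → Carrier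
  sgn σ = signPow (inversions σ)

  basisVec : ∀ {n} → Fin n → Fin n → Carrier
  basisVec j k with does (j ≟ k)
  ... | true  = 1#
  ... | false = 0#

  elementary : ∀ {n s} → (Fin s → Fin n → Carrier) → Tensor n s
  elementary {s = s} v idx = Π[< s ] (λ a → v a (idx a))

  basisTensor : ∀ {n s} → (Fin s → Fin n) → Tensor n s
  basisTensor j = elementary (λ a → basisVec (j a))

  permutations : (s : ℕ) → List (Fin s → Fin s)
  permutations s = filter injective? (allFuns s s)

  antisymGen : ∀ {n s} → (Fin s → Fin n) → Tensor n s
  antisymGen {s = s} i = sumᵀ (map (λ σ → sgn σ ·ᵀ basisTensor (λ a → i (σ a))) (permutations s))

  InAntisymmetric : ∀ {n s} → Tensor n s → Set (c ⊔ ℓ)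
  InAntisymmetric {n} {s} T =
    ∃ λ (comb : List (Carrier × (Fin s → Fin n))) →
      All (λ p → StrictlyIncreasing (proj₂ p)) comb
      × T ≈ᵀ sumᵀ (map (λ p → proj₁ p ·ᵀ antisymGen (proj₂ p)) comb)

  SumOfElementary : ∀ {n s} → Tensor n s → ℕ → Set (c ⊔ ℓ)
  SumOfElementary {n} {s} T r =
    ∃ λ (v : Fin r → Fin s → Fin n → Carrier) →
      ∀ idx → T idx ≈ Σ[< r ] (λ k → elementary (v k) idx)

  TrankAtLeast : ∀ {n s} → Tensor n s → ℕ → Set (c ⊔ ℓ)
  TrankAtLeast T m = ∀ r → SumOfElementary T r → m ℕ.≤ r

{-# OPTIONS --safe #-}
-- Pick an index y with T y ≉ 0 and flatten T along its first factor to the s × s matrix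
-- D j k = T (y j ∷ y ∘ punchIn k). Off the diagonal this index contains y j twice, so D j k ≈ 0.
-- On the diagonal D k k = T (y ∘ ρ) for a permutation ρ; every generator that contributes at
-- y ∘ ρ is the increasing rearrangement of y, so T (y ∘ ρ) ≈ w * sgn (π ∘ ρ) with w independent
-- of ρ, and w ≉ 0 because T y ≉ 0. A decomposition of T into r elementary tensors factors D
-- through F^r, and Gaussian elimination shows that a nonsingular diagonal s × s matrix does not
-- factor through fewer than s dimensions. Choosing y and the pivots is done under double
-- negation, which is harmless since s ≤ r is decidable.
module Submission where

open import Defs
open import Level using (Level; 0ℓ; _⊔_)
open import Data.Nat as ℕ using (ℕ; zero; suc; _≤_; z≤n; s≤s)
import Data.Nat.Properties as ℕ
open import Data.Fin as Fin using (Fin; zero; suc; punchIn; punchOut)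
import Data.Fin.Properties as Fin
open import Data.Fin.Induction using (<-wellFounded)
import Data.Vec.Functional as VF
open import Data.List as List using (List; []; _∷_; _++_; allFin; filter)
open import Data.List.Relation.Unary.All as All using (All; []; _∷_)
open import Data.List.Relation.Unary.All.Properties using (all-filter; ¬Any⇒All¬)
import Data.List.Relation.Unary.Any as Any
open import Data.List.Properties using (filter-≐)
open import Data.Product using (∃; ∃₂; _×_; _,_; proj₁; proj₂)
open import Data.Sum using (_⊎_; inj₁; inj₂)
open import Data.Empty using (⊥-elim)
open import Function using (_∘_; _$_; id)
open import Induction.WellFounded using (module All)
open import Relation.Binary using (tri<; tri≈; tri>)
open import Relation.Binary.PropositionalEquality as ≡
  using (_≡_; _≢_; _≗_; refl; subst₂)
open import Relation.Nullary using (¬_; Dec; yes; no; does)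
open import Data.Bool using (if_then_else_)
open import Relation.Unary using (Decidable)
open import Relation.Nullary.Negation using (¬¬-map)
open import Relation.Nullary.Decidable using (decidable-stable)

module _ {s n : ℕ} {J : Fin s → Fin n} (J↑ : StrictlyIncreasing J) where

  strictlyIncreasing⇒injective : Injective J
  strictlyIncreasing⇒injective a b Ja≡Jb with Fin.<-cmp a b
  ... | tri< a<b _ _ = ⊥-elim (Fin.<-irrefl Ja≡Jb (J↑ a b a<b))
  ... | tri≈ _ a≡b _ = a≡b
  ... | tri> _ _ b<a = ⊥-elim (Fin.<-irrefl (≡.sym Ja≡Jb) (J↑ b a b<a))

  strictlyIncreasing-reflects-< : ∀ a b → J a Fin.< J b → a Fin.< b
  strictlyIncreasing-reflects-< a b Ja<Jb with Fin.<-cmp a b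
  ... | tri< a<b _ _ = a<b
  ... | tri≈ _ refl _ = ⊥-elim (Fin.<-irrefl refl Ja<Jb)
  ... | tri> _ _ b<a = ⊥-elim (Fin.<-asym Ja<Jb (J↑ b a b<a))

_⊆ᵢₘ_ : ∀ {s t n} → (Fin s → Fin n) → (Fin t → Fin n) → Set
f ⊆ᵢₘ g = ∀ a → ∃ λ b → f a ≡ g b

-- Were J a = J′ b with a ≠ b, then one of J, J′ would take the value at a already
-- at some smaller index, where by induction J and J′ agree.
strictlyIncreasing-image-unique : ∀ {s n} {J J′ : Fin s → Fin n} →
  StrictlyIncreasing J → StrictlyIncreasing J′ → J ⊆ᵢₘ J′ → J′ ⊆ᵢₘ J → J ≗ J′
strictlyIncreasing-image-unique {J = J} {J′} J↑ J′↑ J⊆J′ J′⊆J =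
  All.wfRec <-wellFounded 0ℓ (λ a → J a ≡ J′ a) step
  where
  step : ∀ a → (∀ {b} → b Fin.< a → J b ≡ J′ b) → J a ≡ J′ a
  step a agree with J⊆J′ a | J′⊆J a
  ... | b , Ja≡J′b | b′ , J′a≡Jb′ with Fin.<-cmp a b
  ...   | tri≈ _ refl _ = Ja≡J′b
  ...   | tri> _ _ b<a = ⊥-elim (Fin.<-irrefl
          (strictlyIncreasing⇒injective J↑ b a (≡.trans (agree b<a) (≡.sym Ja≡J′b))) b<a)
  ...   | tri< a<b _ _ = ⊥-elim (Fin.<-irrefl
          (strictlyIncreasing⇒injective J′↑ b′ a (≡.trans (≡.sym (agree b′<a)) (≡.sym J′a≡Jb′))) b′<a)
    where
    b′<a : b′ Fin.< a
    b′<a = strictlyIncreasing-reflects-< J↑ b′ a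
             (subst₂ Fin._<_ J′a≡Jb′ (≡.sym Ja≡J′b) (J′↑ a b a<b))

injective⇒surjective : ∀ {s} (σ : Fin s → Fin s) → Injective σ → ∀ b → ∃ λ a → σ a ≡ b
injective⇒surjective {zero}  σ σ-inj ()
injective⇒surjective {suc s} σ σ-inj b with Fin.any? (λ a → σ a Fin.≟ b)
... | yes hit = hit
... | no miss
  with i , j , i<j , eq ← Fin.pigeonhole (ℕ.n<1+n s) (λ a → punchOut (miss ∘ (a ,_) ∘ ≡.sym))
  = ⊥-elim (Fin.<-irrefl (σ-inj i j (Fin.punchOut-injective (miss ∘ (i ,_) ∘ ≡.sym)
                                                            (miss ∘ (j ,_) ∘ ≡.sym) eq)) i<j)

⊆ᵢₘ-trans : ∀ {s t u n} {f : Fin s → Fin n} {g : Fin t → Fin n} {h : Fin u → Fin n} →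
  f ⊆ᵢₘ g → g ⊆ᵢₘ h → f ⊆ᵢₘ h
⊆ᵢₘ-trans f⊆g g⊆h a with f⊆g a
... | b , fa≡gb with g⊆h b
...   | c , gb≡hc = c , ≡.trans fa≡gb gb≡hc

⊆ᵢₘ-witness-injective : ∀ {s t n} {y : Fin s → Fin n} {g : Fin t → Fin n} →
  Injective y → (y⊆g : y ⊆ᵢₘ g) → Injective (proj₁ ∘ y⊆g)
⊆ᵢₘ-witness-injective {g = g} y-inj y⊆g a b πa≡πb =
  y-inj a b (≡.trans (proj₂ (y⊆g a)) (≡.trans (≡.cong g πa≡πb) (≡.sym (proj₂ (y⊆g b)))))

-- The witnesses of y ⊆ᵢₘ g form an injective, hence surjective, self-map of Fin s.
injective-⊆ᵢₘ⇒⊇ᵢₘ : ∀ {s n} {y g : Fin s → Fin n} → Injective y → y ⊆ᵢₘ g → g ⊆ᵢₘ y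
injective-⊆ᵢₘ⇒⊇ᵢₘ {g = g} y-inj y⊆g a =
  let b , πb≡a = injective⇒surjective (proj₁ ∘ y⊆g) (⊆ᵢₘ-witness-injective y-inj y⊆g) a
  in b , ≡.trans (≡.cong g (≡.sym πb≡a)) (≡.sym (proj₂ (y⊆g b)))

cons-punchIn-injective : ∀ {s} (k : Fin (suc s)) → Injective (k VF.∷ punchIn k)
cons-punchIn-injective k zero    zero    _  = refl
cons-punchIn-injective k zero    (suc b) eq = ⊥-elim (Fin.punchInᵢ≢i k b (≡.sym eq))
cons-punchIn-injective k (suc a) zero    eq = ⊥-elim (Fin.punchInᵢ≢i k a eq)
cons-punchIn-injective k (suc a) (suc b) eq = ≡.cong suc (Fin.punchIn-injective k a b eq)

¬¬-∀-Fin : ∀ {p m} {P : Fin m → Set p} → (∀ i → ¬ ¬ P i) → ¬ ¬ (∀ i → P i)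
¬¬-∀-Fin {m = zero}  _      k = k (λ ())
¬¬-∀-Fin {m = suc m} ¬¬P k =
  ¬¬P zero λ P0 → ¬¬-∀-Fin (¬¬P ∘ suc) λ Psuc → k λ { zero → P0 ; (suc i) → Psuc i }

¬¬-all⊎counterexample : ∀ {p m} (P : Fin m → Set p) → ¬ ¬ ((∀ i → P i) ⊎ ∃ λ i → ¬ P i)
¬¬-all⊎counterexample P k = ¬¬-∀-Fin (λ i ¬Pi → k (inj₂ (i , ¬Pi))) (k ∘ inj₁)

¬¬-∀-Fin→Fin : ∀ {p s m} {P : (Fin s → Fin m) → Set p} →
  (∀ {f g} → f ≗ g → P f → P g) → (∀ f → ¬ ¬ P f) → ¬ ¬ (∀ f → P f)
¬¬-∀-Fin→Fin {s = zero}  resp ¬¬P k = ¬¬P (λ ()) λ P₀ → k λ f → resp (λ ()) P₀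
¬¬-∀-Fin→Fin {s = suc s} {P = P} resp ¬¬P k =
  ¬¬-∀-Fin→Fin {P = λ t → ∀ x → P (x VF.∷ t)}
    (λ t≗t′ Pt x → resp (λ { zero → refl ; (suc a) → t≗t′ a }) (Pt x))
    (λ t → ¬¬-∀-Fin (λ x → ¬¬P (x VF.∷ t)))
    λ P∷ → k λ f → resp (λ { zero → refl ; (suc a) → refl }) (P∷ (f ∘ suc) (f zero))

module OverField {c ℓ : Level} (F : Field c ℓ) where

  open Field F hiding (zero) renaming (refl to ≈-refl)
  open FieldDefs F
  open import Relation.Binary.Reasoning.Setoid setoid
  open import Algebra.Properties.Group +-group using (⁻¹-injective; ε⁻¹≈ε)
  open import Algebra.Properties.CommutativeSemigroup +-commutativeSemigroup using (interchange)
  open import Algebra.Properties.Ring ring using (-‿distribˡ-*)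

  signPow≉0 : ∀ k → ¬ signPow k ≈ 0#
  signPow≉0 zero    1≈0  = 0≉1 (sym 1≈0)
  signPow≉0 (suc k) -x≈0 = signPow≉0 k (⁻¹-injective (trans -x≈0 (sym ε⁻¹≈ε)))

  sgn≉0 : ∀ {s} (σ : Fin s → Fin s) → ¬ sgn σ ≈ 0#
  sgn≉0 σ = signPow≉0 (inversions σ)

  sgn-cong : ∀ {s} {σ σ′ : Fin s → Fin s} → σ ≗ σ′ → sgn σ ≡ sgn σ′
  sgn-cong {s} σ≗σ′ = ≡.cong (signPow ∘ List.length)
    (filter-≐ _ _ (respect σ≗σ′ , respect (≡.sym ∘ σ≗σ′)) (List.cartesianProduct (allFin s) (allFin s)))
    where
    respect : ∀ {σ σ′ : Fin s → Fin s} → σ ≗ σ′ → ∀ {p : Fin s × Fin s} →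
      proj₁ p Fin.< proj₂ p × σ (proj₂ p) Fin.< σ (proj₁ p) →
      proj₁ p Fin.< proj₂ p × σ′ (proj₂ p) Fin.< σ′ (proj₁ p)
    respect σ≗σ′ (i<j , σj<σi) = i<j , subst₂ Fin._<_ (σ≗σ′ _) (σ≗σ′ _) σj<σi

  *-≉0 : ∀ {x y} → ¬ x ≈ 0# → ¬ y ≈ 0# → ¬ x * y ≈ 0#
  *-≉0 {x} {y} x≉0 y≉0 xy≈0 with x⁻¹ , xx⁻¹≈1 ← inverse x x≉0 = y≉0 (begin
    y                ≈⟨ *-identityˡ y ⟨
    1# * y           ≈⟨ *-congʳ xx⁻¹≈1 ⟨
    (x * x⁻¹) * y    ≈⟨ *-congʳ (*-comm x x⁻¹) ⟩
    (x⁻¹ * x) * y    ≈⟨ *-assoc x⁻¹ x y ⟩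
    x⁻¹ * (x * y)    ≈⟨ *-congˡ xy≈0 ⟩
    x⁻¹ * 0#         ≈⟨ zeroʳ x⁻¹ ⟩
    0#               ∎)

  listSum : ∀ {a} {A : Set a} → (A → Carrier) → List A → Carrier
  listSum f []       = 0#
  listSum f (x ∷ xs) = f x + listSum f xs

  module _ {a} {A : Set a} where

    sumᵀ-map-apply : ∀ {n s} (g : A → Tensor n s) xs x →
      sumᵀ (List.map g xs) x ≡ listSum (λ a → g a x) xs
    sumᵀ-map-apply g []       x = refl
    sumᵀ-map-apply g (a ∷ xs) x = ≡.cong (g a x +_) (sumᵀ-map-apply g xs x)

    listSum-congᴬ : ∀ {f g : A → Carrier} {xs} →
      All (λ a → f a ≈ g a) xs → listSum f xs ≈ listSum g xs
    listSum-congᴬ []             = ≈-refl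
    listSum-congᴬ (fa≈ga ∷ eqs) = +-cong fa≈ga (listSum-congᴬ eqs)

    listSum-cong : ∀ {f g : A → Carrier} → (∀ a → f a ≈ g a) → ∀ xs → listSum f xs ≈ listSum g xs
    listSum-cong f≈g xs = listSum-congᴬ (All.universal f≈g xs)

    listSum-zero : ∀ {f : A → Carrier} {xs} → All (λ a → f a ≈ 0#) xs → listSum f xs ≈ 0#
    listSum-zero []            = ≈-refl
    listSum-zero (fa≈0 ∷ eqs) = trans (+-cong fa≈0 (listSum-zero eqs)) (+-identityʳ 0#)

    listSum-*ʳ : ∀ (f : A → Carrier) k xs → listSum (λ a → f a * k) xs ≈ listSum f xs * k
    listSum-*ʳ f k []       = sym (zeroˡ k)
    listSum-*ʳ f k (x ∷ xs) =
      trans (+-congˡ (listSum-*ʳ f k xs)) (sym (distribʳ k (f x) (listSum f xs)))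

    listSum-++ : ∀ (f : A → Carrier) xs ys → listSum f (xs ++ ys) ≈ listSum f xs + listSum f ys
    listSum-++ f []       ys = sym (+-identityˡ _)
    listSum-++ f (x ∷ xs) ys = trans (+-congˡ (listSum-++ f xs ys)) (sym (+-assoc _ _ _))

    listSum-filter : ∀ {p} {P : A → Set p} (P? : Decidable P) (f : A → Carrier) →
      (∀ a → ¬ P a → f a ≈ 0#) → ∀ xs → listSum f (filter P? xs) ≈ listSum f xs
    listSum-filter P? f off []       = ≈-refl
    listSum-filter P? f off (x ∷ xs) with P? x
    ... | yes _  = +-congˡ (listSum-filter P? f off xs)
    ... | no ¬Px = trans (listSum-filter P? f off xs)
                         (trans (sym (+-identityˡ _)) (+-congʳ (sym (off x ¬Px))))

    listSum-map : ∀ {b} {B : Set b} (f : A → Carrier) (g : B → A) xs →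
      listSum f (List.map g xs) ≡ listSum (f ∘ g) xs
    listSum-map f g []       = refl
    listSum-map f g (x ∷ xs) = ≡.cong (f (g x) +_) (listSum-map f g xs)

    listSum-concatMap : ∀ {b} {B : Set b} (f : A → Carrier) (g : B → List A) xs →
      listSum f (List.concatMap g xs) ≈ listSum (listSum f ∘ g) xs
    listSum-concatMap f g []       = ≈-refl
    listSum-concatMap f g (x ∷ xs) =
      trans (listSum-++ f (g x) (List.concatMap g xs)) (+-congˡ (listSum-concatMap f g xs))

  listSum-allFin : ∀ {m} (f : Fin m → Carrier) → listSum f (allFin m) ≡ Σ[< m ] f
  listSum-allFin {m} f = go {m} id
    where
    go : ∀ {k} (g : Fin k → Fin m) → listSum f (List.tabulate g) ≡ Σ[< k ] (f ∘ g)
    go {zero}  g = refl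
    go {suc k} g = ≡.cong (f (g zero) +_) (go (g ∘ suc))

  Σ-zero : ∀ {m} {f : Fin m → Carrier} → (∀ i → f i ≈ 0#) → Σ[< m ] f ≈ 0#
  Σ-zero {zero}  f≈0 = ≈-refl
  Σ-zero {suc m} f≈0 = trans (+-cong (f≈0 zero) (Σ-zero (f≈0 ∘ suc))) (+-identityʳ 0#)

  Σ-delta : ∀ {m} {f : Fin m → Carrier} i → (∀ j → j ≢ i → f j ≈ 0#) → Σ[< m ] f ≈ f i
  Σ-delta zero    off = trans (+-congˡ (Σ-zero (λ j → off (suc j) λ ()))) (+-identityʳ _)
  Σ-delta (suc i) off =
    trans (+-cong (off zero λ ()) (Σ-delta i (λ j j≢i → off (suc j) (j≢i ∘ Fin.suc-injective))))
          (+-identityˡ _)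

  Σ-linear : ∀ {r} (x y b : Fin r → Carrier) k →
    Σ[< r ] (λ m → (x m + k * y m) * b m) ≈ Σ[< r ] (λ m → x m * b m) + k * Σ[< r ] (λ m → y m * b m)
  Σ-linear {zero}  x y b k = sym (trans (+-identityˡ _) (zeroʳ k))
  Σ-linear {suc r} x y b k = begin
    (x zero + k * y zero) * b zero + Σ[< r ] (λ m → (x (suc m) + k * y (suc m)) * b (suc m))
      ≈⟨ +-cong (trans (distribʳ _ _ _) (+-congˡ (*-assoc _ _ _)))
                (Σ-linear (x ∘ suc) (y ∘ suc) (b ∘ suc) k) ⟩
    (x zero * b zero + k * (y zero * b zero)) + (X + k * Y)
      ≈⟨ interchange _ _ _ _ ⟩
    (x zero * b zero + X) + (k * (y zero * b zero) + k * Y)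
      ≈⟨ +-congˡ (distribˡ k _ _) ⟨
    (x zero * b zero + X) + k * (y zero * b zero + Y) ∎
    where
    X Y : Carrier
    X = Σ[< r ] (λ m → x (suc m) * b (suc m))
    Y = Σ[< r ] (λ m → y (suc m) * b (suc m))

  Π-zero : ∀ {m} {f : Fin m → Carrier} i → f i ≈ 0# → Π[< m ] f ≈ 0#
  Π-zero zero    fi≈0 = trans (*-congʳ fi≈0) (zeroˡ _)
  Π-zero (suc i) fi≈0 = trans (*-congˡ (Π-zero i fi≈0)) (zeroʳ _)

  Π-cong : ∀ {m} {f g : Fin m → Carrier} → (∀ i → f i ≈ g i) → Π[< m ] f ≈ Π[< m ] g
  Π-cong {zero}  f≈g = ≈-refl
  Π-cong {suc m} f≈g = *-cong (f≈g zero) (Π-cong (f≈g ∘ suc))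

  Π-one : ∀ {m} {f : Fin m → Carrier} → (∀ i → f i ≈ 1#) → Π[< m ] f ≈ 1#
  Π-one {zero}  f≈1 = ≈-refl
  Π-one {suc m} f≈1 = trans (*-cong (f≈1 zero) (Π-one (f≈1 ∘ suc))) (*-identityˡ 1#)

  basisVec-≡ : ∀ {n} {j k : Fin n} → j ≡ k → basisVec j k ≈ 1#
  basisVec-≡ {j = j} {k} j≡k with j Fin.≟ k
  ... | yes _   = ≈-refl
  ... | no j≢k = ⊥-elim (j≢k j≡k)

  basisVec-≢ : ∀ {n} {j k : Fin n} → j ≢ k → basisVec j k ≈ 0#
  basisVec-≢ {j = j} {k} j≢k with j Fin.≟ k
  ... | yes j≡k = ⊥-elim (j≢k j≡k)
  ... | no _    = ≈-refl

  basisTensor-≗ : ∀ {n s} {j x : Fin s → Fin n} → j ≗ x → basisTensor j x ≈ 1#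
  basisTensor-≗ j≗x = Π-one (basisVec-≡ ∘ j≗x)

  basisTensor-≭ : ∀ {n s} {j x : Fin s → Fin n} → ¬ j ≗ x → basisTensor j x ≈ 0#
  basisTensor-≭ {s = s} {j} {x} j≭x with a , ja≢xa ← Fin.¬∀⟶∃¬ s _ (λ a → j a Fin.≟ x a) j≭x =
    Π-zero a (basisVec-≢ ja≢xa)

  elementary-cong : ∀ {n s} (v : Fin s → Fin n → Carrier) {x x′ : Fin s → Fin n} →
    x ≗ x′ → elementary v x ≈ elementary v x′
  elementary-cong v x≗x′ = Π-cong (λ a → reflexive (≡.cong (v a) (x≗x′ a)))

  listSum-allFuns-delta : ∀ {s m} (h : (Fin s → Fin m) → Carrier) (g : Fin s → Fin m) {K} →
    (∀ f → f ≗ g → h f ≈ K) → (∀ f → ¬ f ≗ g → h f ≈ 0#) → listSum h (allFuns s m) ≈ K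
  listSum-allFuns-delta {zero} h g hit miss = trans (+-identityʳ _) (hit (λ ()) (λ ()))
  listSum-allFuns-delta {suc s} {m} h g {K} hit miss =
    trans (listSum-concatMap h extensions (allFuns s m))
          (listSum-allFuns-delta (listSum h ∘ extensions) (g ∘ suc) hit′ miss′)
    where
    extensions : (Fin s → Fin m) → List (Fin (suc s) → Fin m)
    extensions f = List.map (VF._∷ f) (allFin m)
    sum-extensions : ∀ f → listSum h (extensions f) ≡ Σ[< m ] (λ x → h (x VF.∷ f))
    sum-extensions f =
      ≡.trans (listSum-map h (VF._∷ f) (allFin m)) (listSum-allFin (λ x → h (x VF.∷ f)))
    hit′ : ∀ f → f ≗ g ∘ suc → listSum h (extensions f) ≈ K
    hit′ f f≗g = trans (reflexive (sum-extensions f)) (trans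
      (Σ-delta (g zero) (λ x x≢g0 → miss (x VF.∷ f) (x≢g0 ∘ (_$ zero))))
      (hit (g zero VF.∷ f) λ { zero → refl ; (suc a) → f≗g a }))
    miss′ : ∀ f → ¬ f ≗ g ∘ suc → listSum h (extensions f) ≈ 0#
    miss′ f f≭g = trans (reflexive (sum-extensions f))
      (Σ-zero (λ x → miss (x VF.∷ f) (f≭g ∘ (_∘ suc))))

  antisymGen-apply : ∀ {n s} (J x : Fin s → Fin n) →
    antisymGen J x ≡ listSum (λ σ → sgn σ * basisTensor (J ∘ σ) x) (permutations s)
  antisymGen-apply {s = s} J = sumᵀ-map-apply (λ σ → sgn σ ·ᵀ basisTensor (J ∘ σ)) (permutations s)

  antisymGen-cong : ∀ {n s} (J : Fin s → Fin n) {x x′} → x ≗ x′ → antisymGen J x ≈ antisymGen J x′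
  antisymGen-cong {s = s} J {x} {x′} x≗x′ = begin
    antisymGen J x ≡⟨ antisymGen-apply J x ⟩
    listSum (λ σ → sgn σ * basisTensor (J ∘ σ) x) (permutations s)
      ≈⟨ listSum-cong (λ σ → *-congˡ (elementary-cong (basisVec ∘ J ∘ σ) x≗x′)) (permutations s) ⟩
    listSum (λ σ → sgn σ * basisTensor (J ∘ σ) x′) (permutations s) ≡⟨ antisymGen-apply J x′ ⟨
    antisymGen J x′ ∎

  permutations-injective : ∀ s → All Injective (permutations s)
  permutations-injective s = all-filter injective? (allFuns s s)

  antisymGen-vanishes : ∀ {n s} (J x : Fin s → Fin n) →
    (∀ σ → Injective σ → ¬ J ∘ σ ≗ x) → antisymGen J x ≈ 0#
  antisymGen-vanishes {s = s} J x unreachable = trans (reflexive (antisymGen-apply J x))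
    (listSum-zero (All.map (λ {σ} σ-inj → trans (*-congˡ (basisTensor-≭ (unreachable σ σ-inj))) (zeroʳ _))
                           (permutations-injective s)))

  -- Since J is injective, J ∘ σ ≗ x = J ∘ π forces σ ≗ π: only the term σ = π survives.
  antisymGen-permuted : ∀ {n s} (J x : Fin s → Fin n) (π : Fin s → Fin s) →
    Injective J → Injective π → J ∘ π ≗ x → antisymGen J x ≈ sgn π
  antisymGen-permuted {s = s} J x π J-inj π-inj Jπ≗x = begin
    antisymGen J x                                  ≡⟨ antisymGen-apply J x ⟩
    listSum term (filter injective? (allFuns s s))
      ≈⟨ listSum-filter injective? term (λ σ σ-noninj → off σ (σ-noninj ∘ injective-≗ σ)) (allFuns s s) ⟩
    listSum term (allFuns s s)                      ≈⟨ listSum-allFuns-delta term π on off ⟩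
    sgn π                                           ∎
    where
    term : (Fin s → Fin s) → Carrier
    term σ = sgn σ * basisTensor (J ∘ σ) x
    ≗π : ∀ σ → J ∘ σ ≗ x → σ ≗ π
    ≗π σ Jσ≗x a = J-inj _ _ (≡.trans (Jσ≗x a) (≡.sym (Jπ≗x a)))
    injective-≗ : ∀ σ → σ ≗ π → Injective σ
    injective-≗ σ σ≗π a b σa≡σb = π-inj a b (≡.trans (≡.sym (σ≗π a)) (≡.trans σa≡σb (σ≗π b)))
    on : ∀ σ → σ ≗ π → term σ ≈ sgn π
    on σ σ≗π = trans (*-cong (reflexive (sgn-cong σ≗π))
                             (basisTensor-≗ (λ a → ≡.trans (≡.cong J (σ≗π a)) (Jπ≗x a))))
                     (*-identityʳ _)
    off : ∀ σ → ¬ σ ≗ π → term σ ≈ 0#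
    off σ σ≭π = trans (*-congˡ (basisTensor-≭ (σ≭π ∘ ≗π σ))) (zeroʳ _)

  module AntisymmetricTensor {n s} {T : Tensor n s} (T-antisym : InAntisymmetric T) where

    private
      comb : List (Carrier × (Fin s → Fin n))
      comb = proj₁ T-antisym

      comb↑ : All (StrictlyIncreasing ∘ proj₂) comb
      comb↑ = proj₁ (proj₂ T-antisym)

      term : (Fin s → Fin n) → Carrier × (Fin s → Fin n) → Carrier
      term x (c , J) = c * antisymGen J x

      expand : ∀ x → T x ≈ listSum (term x) comb
      expand x = trans (proj₂ (proj₂ T-antisym) x) (reflexive (sumᵀ-map-apply _ comb x))

    antisymmetric-cong : ∀ {x x′} → x ≗ x′ → T x ≈ T x′
    antisymmetric-cong {x} {x′} x≗x′ = begin
      T x                    ≈⟨ expand x ⟩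
      listSum (term x) comb  ≈⟨ listSum-cong (λ p → *-congˡ (antisymGen-cong (proj₂ p) x≗x′)) comb ⟩
      listSum (term x′) comb ≈⟨ expand x′ ⟨
      T x′                   ∎

    antisymmetric-repeated : ∀ {x} {a b} → a ≢ b → x a ≡ x b → T x ≈ 0#
    antisymmetric-repeated {x} {a} {b} a≢b xa≡xb =
      trans (expand x) (listSum-zero (All.map vanishes comb↑))
      where
      vanishes : ∀ {p} → StrictlyIncreasing (proj₂ p) → term x p ≈ 0#
      vanishes {c , J} J↑ = trans (*-congˡ (antisymGen-vanishes J x λ σ σ-inj Jσ≗x →
          a≢b (σ-inj a b (strictlyIncreasing⇒injective J↑ _ _
            (≡.trans (Jσ≗x a) (≡.trans xa≡xb (≡.sym (Jσ≗x b))))))))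
        (zeroʳ c)

    antisymmetric-nonzero⇒injective : ∀ {y} → ¬ T y ≈ 0# → Injective y
    antisymmetric-nonzero⇒injective Ty≉0 a b ya≡yb with a Fin.≟ b
    ... | yes a≡b = a≡b
    ... | no a≢b  = ⊥-elim (Ty≉0 (antisymmetric-repeated a≢b ya≡yb))

    antisymmetric-nonzero-entry : ¬ T ≈ᵀ zeroᵀ → ¬ ¬ ∃ λ y → ¬ T y ≈ 0#
    antisymmetric-nonzero-entry T≉0 no-entry = ¬¬-∀-Fin→Fin
      (λ x≗x′ Tx≈0 → trans (sym (antisymmetric-cong x≗x′)) Tx≈0)
      (λ y Ty≉0 → no-entry (y , Ty≉0))
      T≉0

    module _ {y : Fin s → Fin n} (Ty≉0 : ¬ T y ≈ 0#) where

      private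
        y-inj : Injective y
        y-inj = antisymmetric-nonzero⇒injective Ty≉0

        covers? : (J : Fin s → Fin n) → Dec (y ⊆ᵢₘ J)
        covers? J = Fin.all? λ a → Fin.any? λ b → y a Fin.≟ J b

        uncovered-vanishes : ∀ J (ρ : Fin s → Fin s) → Injective ρ → ¬ y ⊆ᵢₘ J →
          antisymGen J (y ∘ ρ) ≈ 0#
        uncovered-vanishes J ρ ρ-inj y⊈J = antisymGen-vanishes J (y ∘ ρ) λ σ _ Jσ≗yρ → y⊈J λ a →
          let b , ρb≡a = injective⇒surjective ρ ρ-inj a
          in σ b , ≡.trans (≡.cong y (≡.sym ρb≡a)) (≡.sym (Jσ≗yρ b))

        covering-generator : ∃ λ J → StrictlyIncreasing J × y ⊆ᵢₘ J
        covering-generator with Any.any? (covers? ∘ proj₂) comb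
        ... | yes some = let (J↑ , y⊆J) = All.lookupAny comb↑ some in _ , J↑ , y⊆J
        ... | no none  = ⊥-elim (Ty≉0 (trans (expand y) (listSum-zero (All.map
              (λ {p} y⊈J → trans (*-congˡ (uncovered-vanishes (proj₂ p) id (λ _ _ → id) y⊈J)) (zeroʳ _))
              (¬Any⇒All¬ comb none)))))

        J₀ : Fin s → Fin n
        J₀ = proj₁ covering-generator

        J₀↑ : StrictlyIncreasing J₀
        J₀↑ = proj₁ (proj₂ covering-generator)

        y⊆J₀ : y ⊆ᵢₘ J₀
        y⊆J₀ = proj₂ (proj₂ covering-generator)

        π₀ : Fin s → Fin s
        π₀ = proj₁ ∘ y⊆J₀

        -- Every covering generator equals J₀, so it contributes sgn (π₀ ∘ ρ) at y ∘ ρ.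
        covered-value : ∀ {J} (ρ : Fin s → Fin s) → Injective ρ → StrictlyIncreasing J → y ⊆ᵢₘ J →
          antisymGen J (y ∘ ρ) ≈ sgn (π₀ ∘ ρ)
        covered-value {J} ρ ρ-inj J↑ y⊆J = antisymGen-permuted J (y ∘ ρ) (π₀ ∘ ρ)
          (strictlyIncreasing⇒injective J↑)
          (λ a b eq → ρ-inj a b (⊆ᵢₘ-witness-injective y-inj y⊆J₀ _ _ eq))
          (λ a → ≡.trans (J≗J₀ (π₀ (ρ a))) (≡.sym (proj₂ (y⊆J₀ (ρ a)))))
          where
          J≗J₀ : J ≗ J₀
          J≗J₀ = strictlyIncreasing-image-unique J↑ J₀↑
            (⊆ᵢₘ-trans (injective-⊆ᵢₘ⇒⊇ᵢₘ y-inj y⊆J) y⊆J₀)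
            (⊆ᵢₘ-trans (injective-⊆ᵢₘ⇒⊇ᵢₘ y-inj y⊆J₀) y⊆J)

        weight : Carrier
        weight = listSum (λ p → if does (covers? (proj₂ p)) then proj₁ p else 0#) comb

        reindexed-value : ∀ (ρ : Fin s → Fin s) → Injective ρ → T (y ∘ ρ) ≈ weight * sgn (π₀ ∘ ρ)
        reindexed-value ρ ρ-inj = trans (expand (y ∘ ρ))
          (trans (listSum-congᴬ (All.map termwise comb↑)) (listSum-*ʳ _ (sgn (π₀ ∘ ρ)) comb))
          where
          termwise : ∀ {p} → StrictlyIncreasing (proj₂ p) →
            term (y ∘ ρ) p ≈ (if does (covers? (proj₂ p)) then proj₁ p else 0#) * sgn (π₀ ∘ ρ)
          termwise {c , J} J↑ = by-cover (covers? J)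
            where
            by-cover : (d : Dec (y ⊆ᵢₘ J)) →
              c * antisymGen J (y ∘ ρ) ≈ (if does d then c else 0#) * sgn (π₀ ∘ ρ)
            by-cover (yes y⊆J) = *-congˡ (covered-value ρ ρ-inj J↑ y⊆J)
            by-cover (no y⊈J)  = trans (*-congˡ (uncovered-vanishes J ρ ρ-inj y⊈J))
                                       (trans (zeroʳ c) (sym (zeroˡ _)))

      -- Comparing with ρ = id shows weight ≉ 0, and signs never vanish.
      antisymmetric-reindex-nonzero : ∀ (ρ : Fin s → Fin s) → Injective ρ → ¬ T (y ∘ ρ) ≈ 0#
      antisymmetric-reindex-nonzero ρ ρ-inj Tyρ≈0 = *-≉0 weight≉0 (sgn≉0 (π₀ ∘ ρ))
        (trans (sym (reindexed-value ρ ρ-inj)) Tyρ≈0)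
        where
        weight≉0 : ¬ weight ≈ 0#
        weight≉0 w≈0 = Ty≉0 (trans (reindexed-value id (λ _ _ → id)) (trans (*-congʳ w≈0) (zeroˡ _)))

  FactorsThrough : ∀ {s t} → (Fin s → Fin t → Carrier) → ℕ → Set (c ⊔ ℓ)
  FactorsThrough {s} {t} D r = ∃₂ λ (A : Fin s → Fin r → Carrier) (B : Fin r → Fin t → Carrier) →
    ∀ j k → D j k ≈ Σ[< r ] (λ m → A j m * B m k)

  record NonsingularDiagonal {s} (D : Fin s → Fin s → Carrier) : Set ℓ where
    field
      off-diagonal : ∀ j k → j ≢ k → D j k ≈ 0#
      diagonal≉0   : ∀ j → ¬ D j j ≈ 0#

  open NonsingularDiagonal

  nonsingularDiagonal-punchIn : ∀ {s} {D : Fin (suc s) → Fin (suc s) → Carrier} →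
    NonsingularDiagonal D → ∀ p → NonsingularDiagonal (λ j k → D (punchIn p j) (punchIn p k))
  nonsingularDiagonal-punchIn D-diag p = record
    { off-diagonal = λ j k j≢k → off-diagonal D-diag _ _ (j≢k ∘ Fin.punchIn-injective p j k)
    ; diagonal≉0   = λ j → diagonal≉0 D-diag (punchIn p j)
    }

  -- Gaussian elimination with pivot A p 0: subtracting multiples of row p of A
  -- clears column 0 without changing the other rows of D, because row p of D vanishes.
  factorsThrough-deleteRow : ∀ {s t r} {D : Fin (suc s) → Fin t → Carrier}
    (A : Fin (suc s) → Fin (suc r) → Carrier) (B : Fin (suc r) → Fin t → Carrier) →
    (∀ j k → D j k ≈ Σ[< suc r ] (λ m → A j m * B m k)) →
    ∀ p → ¬ A p zero ≈ 0# → (∀ k → D p k ≈ 0#) → FactorsThrough (D ∘ punchIn p) r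
  factorsThrough-deleteRow {r = r} {D} A B D≈AB p pivot≉0 row-p≈0
    with a⁻¹ , aa⁻¹≈1 ← inverse (A p zero) pivot≉0 = A′ , B ∘ suc , D′≈A′B
    where
    coeff : Fin _ → Carrier
    coeff j = - (A (punchIn p j) zero * a⁻¹)
    A′ : Fin _ → Fin r → Carrier
    A′ j m = A (punchIn p j) (suc m) + coeff j * A p (suc m)
    pivot-cleared : ∀ x → x + - (x * a⁻¹) * A p zero ≈ 0#
    pivot-cleared x = begin
      x + - (x * a⁻¹) * A p zero    ≈⟨ +-congˡ (-‿distribˡ-* _ _) ⟨
      x + - ((x * a⁻¹) * A p zero)  ≈⟨ +-congˡ (-‿cong (*-assoc _ _ _)) ⟩
      x + - (x * (a⁻¹ * A p zero))  ≈⟨ +-congˡ (-‿cong (*-congˡ (trans (*-comm _ _) aa⁻¹≈1))) ⟩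
      x + - (x * 1#)                ≈⟨ +-congˡ (-‿cong (*-identityʳ x)) ⟩
      x + - x                       ≈⟨ -‿inverseʳ x ⟩
      0#                            ∎
    D′≈A′B : ∀ j k → D (punchIn p j) k ≈ Σ[< r ] (λ m → A′ j m * B (suc m) k)
    D′≈A′B j k = begin
      D (punchIn p j) k                                 ≈⟨ +-identityʳ _ ⟨
      D (punchIn p j) k + 0#                            ≈⟨ +-congˡ (trans (*-congˡ (row-p≈0 k)) (zeroʳ _)) ⟨
      D (punchIn p j) k + coeff j * D p k               ≈⟨ +-cong (D≈AB _ k) (*-congˡ (D≈AB p k)) ⟩
      Σ[< suc r ] (λ m → A (punchIn p j) m * B m k) + coeff j * Σ[< suc r ] (λ m → A p m * B m k)
        ≈⟨ Σ-linear (A (punchIn p j)) (A p) (λ m → B m k) (coeff j) ⟨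
      (A (punchIn p j) zero + coeff j * A p zero) * B zero k + Σ[< r ] (λ m → A′ j m * B (suc m) k)
        ≈⟨ +-congʳ (trans (*-congʳ (pivot-cleared (A (punchIn p j) zero))) (zeroˡ _)) ⟩
      0# + Σ[< r ] (λ m → A′ j m * B (suc m) k)         ≈⟨ +-identityˡ _ ⟩
      Σ[< r ] (λ m → A′ j m * B (suc m) k)              ∎

  nonsingularDiagonal-factorsThrough⇒≤ : ∀ {s r} {D : Fin s → Fin s → Carrier} →
    NonsingularDiagonal D → FactorsThrough D r → s ≤ r
  nonsingularDiagonal-factorsThrough⇒≤ {zero}          _      _               = z≤n
  nonsingularDiagonal-factorsThrough⇒≤ {suc s} {zero}  D-diag (_ , _ , D≈AB) =
    ⊥-elim (diagonal≉0 D-diag zero (D≈AB zero zero))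
  nonsingularDiagonal-factorsThrough⇒≤ {suc s} {suc r} D-diag (A , B , D≈AB) =
    decidable-stable (suc s ℕ.≤? suc r)
      (¬¬-map by-first-column (¬¬-all⊎counterexample (λ j → A j zero ≈ 0#)))
    where
    by-first-column : (∀ j → A j zero ≈ 0#) ⊎ (∃ λ p → ¬ A p zero ≈ 0#) → suc s ≤ suc r
    by-first-column (inj₁ column≈0) = ℕ.m≤n⇒m≤1+n (nonsingularDiagonal-factorsThrough⇒≤ D-diag
      ((λ j m → A j (suc m)) , B ∘ suc , λ j k →
        trans (D≈AB j k) (trans (+-congʳ (trans (*-congʳ (column≈0 j)) (zeroˡ _))) (+-identityˡ _))))
    by-first-column (inj₂ (p , pivot≉0)) = s≤s (nonsingularDiagonal-factorsThrough⇒≤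
      (nonsingularDiagonal-punchIn D-diag p)
      (factorsThrough-deleteRow A (λ m → B m ∘ punchIn p) (λ j → D≈AB j ∘ punchIn p) p pivot≉0
        (λ k → off-diagonal D-diag p (punchIn p k) (Fin.punchInᵢ≢i p k ∘ ≡.sym))))

  sumOfElementary⇒flattening-factorsThrough : ∀ {n s t u r} {T : Tensor n (suc s)} →
    SumOfElementary T r → (x : Fin t → Fin n) (z : Fin u → Fin s → Fin n) →
    FactorsThrough (λ j k → T (x j VF.∷ z k)) r
  sumOfElementary⇒flattening-factorsThrough (v , T≈Σ) x z =
    (λ j m → v m zero (x j)) , (λ m k → elementary (v m ∘ suc) (z k)) , λ j k → T≈Σ (x j VF.∷ z k)

  -- Row j, column k is T at y ∘ (k ∷ punchIn k) with its first index replaced by y j;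
  -- off the diagonal y j then occurs twice.
  antisymmetric-flattening-nonsingularDiagonal : ∀ {n s} {T : Tensor n (suc s)} →
    InAntisymmetric T → ∀ {y} → ¬ T y ≈ 0# → NonsingularDiagonal (λ j k → T (y j VF.∷ (y ∘ punchIn k)))
  antisymmetric-flattening-nonsingularDiagonal T-antisym {y} Ty≉0 = record
    { off-diagonal = λ j k j≢k →
        antisymmetric-repeated {a = zero} {b = suc (punchOut (j≢k ∘ ≡.sym))} (λ ())
          (≡.sym (≡.cong y (Fin.punchIn-punchOut (j≢k ∘ ≡.sym))))
    ; diagonal≉0 = λ k Tk≈0 →
        antisymmetric-reindex-nonzero Ty≉0 (k VF.∷ punchIn k) (cons-punchIn-injective k)
          (trans (antisymmetric-cong (λ { zero → refl ; (suc a) → refl })) Tk≈0)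
    }
    where open AntisymmetricTensor T-antisym

lemma6p3 : ∀ {c ℓ} (F : Field c ℓ) (n s : ℕ) → 1 ≤ n → 1 ≤ s →
    (T : FieldDefs.Tensor F n s) →
    FieldDefs.InAntisymmetric F T →
    ¬ (FieldDefs._≈ᵀ_ F T (FieldDefs.zeroᵀ F)) →
    FieldDefs.TrankAtLeast F T s
lemma6p3 F n (suc s) _ _ T T-antisym T≉0 r T=Σv =
  decidable-stable (suc s ℕ.≤? r) (¬¬-map rank-bound (antisymmetric-nonzero-entry T≉0))
  where
  open Field F using (_≈_; 0#)
  open OverField F
  open AntisymmetricTensor T-antisym
  rank-bound : (∃ λ y → ¬ T y ≈ 0#) → suc s ≤ r
  rank-bound (y , Ty≉0) = nonsingularDiagonal-factorsThrough⇒≤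
    (antisymmetric-flattening-nonsingularDiagonal T-antisym Ty≉0)
    (sumOfElementary⇒flattening-factorsThrough T=Σv y (λ k → y ∘ punchIn k))
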